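{- If $G$ is isomorphic to one of the four graphs $\overline{C_6}^+$, $W_6$, $W_6^+$, $W_6^{++}$ (defined in the context), then every $b$-invariant edge of $G$ is solitary.
   Context: All graphs are finite and simple. A connected graph with at least one edge is matching covered if every edge lies in some perfect matching. For $X\subseteq V(G)$, the cut $\partial(X)$ is the set of edges with exactly one end in $X$; it is tight if every perfect matching of $G$ contains exactly one edge of $\partial(X)$, and nontrivial if $|X|\ge 2$ and $|V(G)\setminus X|\ge 2$. A brick is a nonbipartite matching covered graph with no nontrivial tight cut. For a matching covered graph with a nontrivial tight cut $\partial(X)$, the two graphs obtained by shrinking $X$, respectively $V(G)\setminus X$, to a single vertex are matching covered; repeatedly applying this until no nontrivial tight cuts remain yields a list of bricks and braces (bipartite such graphs), and the number of bricks in the list is independent of the choices made; it is denoted $b(G)$. An edge $e$ of a matching covered graph $G$ is removable if $G-e$ is matching covered, and a removable edge $e$ is $b$-invariant if $b(G-e)=b(G)$. An edge is solitary if it lies in exactly one perfect matching of $G$. The graphs: $\overline{C_6}^+$ is the triangular prism (triangles $a_1a_2a_3$, $b_1b_2b_3$ and edges $a_ib_i$, $i=1,2,3$) together with one additional edge $a_1b_2$; $W_6$ is the wheel on six vertices, a vertex $y_0$ adjacent to all vertices of a 5-cycle $y_1y_2y_3y_4y_5y_1$; $W_6^+$ is $W_6$ plus the edge $y_1y_4$; $W_6^{++}$ is $W_6$ plus the two edges $y_1y_3$ and $y_1y_4$. -}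

module Defs where

open import Data.Nat using (ℕ; zero; suc; _+_; _≥_)
open import Data.Fin using (Fin; zero; suc; _≟_; #_)
open import Data.Bool using (Bool; true; false; _∧_; _∨_; not; if_then_else_)
open import Data.List using (List; []; _∷_)
open import Data.Bool.ListAction using (any)
open import Data.Product using (Σ; _×_; _,_; proj₁)
open import Relation.Nullary using (¬_)
open import Relation.Nullary.Decidable using (⌊_⌋)
open import Relation.Binary.PropositionalEquality using (_≡_; _≢_)
open import Function.Bundles using (_↔_; Inverse)
open import Function using (_∘_)

-- Graphs on the vertex set Fin n, given by a Boolean adjacency relation.
-- (Simplicity -- symmetry and irreflexivity -- is not a field; all graphs
-- that occur in the theorem are simple: the named graphs are, G is
-- isomorphic to one of them, edge deletion preserves simplicity, and the
-- shrinking relation below fully determines a simple graph.)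

Graph : ℕ → Set
Graph n = Fin n → Fin n → Bool

fromEdges : ∀ {n} → List (Fin n × Fin n) → Graph n
fromEdges es a b = any (λ { (x , y) → (⌊ a ≟ x ⌋ ∧ ⌊ b ≟ y ⌋) ∨ (⌊ a ≟ y ⌋ ∧ ⌊ b ≟ x ⌋) }) es

_─_ : ∀ {n} → Graph n → Fin n × Fin n → Graph n
(G ─ (u , v)) a b = G a b ∧ not ((⌊ a ≟ u ⌋ ∧ ⌊ b ≟ v ⌋) ∨ (⌊ a ≟ v ⌋ ∧ ⌊ b ≟ u ⌋))

count : ∀ {n} → (Fin n → Bool) → ℕ
count {zero} p = 0
count {suc n} p = (if p zero then 1 else 0) + count (p ∘ suc)

-- Perfect matchings, represented by the mate function:
-- every vertex v is matched to m v by an edge of G, and m is an involution.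
-- The edge uv lies in the matching iff m u ≡ v.

record PerfectMatching {n} (G : Graph n) : Set where
  field
    mate     : Fin n → Fin n
    isEdge   : ∀ v → G v (mate v) ≡ true
    involut  : ∀ v → mate (mate v) ≡ v
open PerfectMatching public

data Reach {n} (G : Graph n) : Fin n → Fin n → Set where
  here : ∀ {u} → Reach G u u
  step : ∀ {u v w} → G u v ≡ true → Reach G v w → Reach G u w

Connected : ∀ {n} → Graph n → Set
Connected G = ∀ u v → Reach G u v

MatchingCovered : ∀ {n} → Graph n → Set
MatchingCovered {n} G =
  Connected G
  × Σ (Fin n) (λ u → Σ (Fin n) (λ v → G u v ≡ true))
  × (∀ u v → G u v ≡ true → Σ (PerfectMatching G) (λ M → mate M u ≡ v))

Bipartite : ∀ {n} → Graph n → Set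
Bipartite {n} G = Σ (Fin n → Bool) (λ c → ∀ u v → G u v ≡ true → c u ≢ c v)

-- Cuts. A vertex set X is a Boolean predicate on Fin n. The edges of a
-- perfect matching M in ∂(X) correspond bijectively to the vertices
-- v ∈ X with mate v ∉ X.

cutCount : ∀ {n} {G : Graph n} → PerfectMatching G → (Fin n → Bool) → ℕ
cutCount M X = count (λ v → X v ∧ not (X (mate M v)))

Tight : ∀ {n} → Graph n → (Fin n → Bool) → Set
Tight G X = ∀ (M : PerfectMatching G) → cutCount M X ≡ 1

Nontrivial : ∀ {n} → (Fin n → Bool) → Set
Nontrivial X = count X ≥ 2 × count (not ∘ X) ≥ 2

NoNontrivialTightCut : ∀ {n} → Graph n → Set
NoNontrivialTightCut {n} G = ∀ (X : Fin n → Bool) → Nontrivial X → ¬ Tight G X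

-- H is obtained from G by shrinking X to a single vertex, via the
-- surjection f : it identifies all of X and is injective elsewhere
-- (outside vertices are not identified with anything). Edges with both
-- ends in X disappear; parallel edges are merged.
record Shrink {n m} (G : Graph n) (X : Fin n → Bool) (H : Graph m) : Set where
  field
    f        : Fin n → Fin m
    surj     : ∀ w → Σ (Fin n) (λ v → f v ≡ w)
    collapse : ∀ u v → X u ≡ true → X v ≡ true → f u ≡ f v
    inj      : ∀ u v → X u ≡ false → f u ≡ f v → u ≡ v
    adj→     : ∀ a b → H a b ≡ true →
               Σ (Fin n) (λ u → Σ (Fin n) (λ v →
                 f u ≡ a × f v ≡ b × G u v ≡ true × a ≢ b))
    adj←     : ∀ a b → (Σ (Fin n) (λ u → Σ (Fin n) (λ v →
                 f u ≡ a × f v ≡ b × G u v ≡ true × a ≢ b))) → H a b ≡ true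

-- Tight cut decompositions: BrickCount G k means some tight cut
-- decomposition of the matching covered graph G produces exactly k bricks.

data BrickCount : ∀ {n} → Graph n → ℕ → Set where
  brick : ∀ {n} {G : Graph n} → MatchingCovered G → ¬ Bipartite G →
          NoNontrivialTightCut G → BrickCount G 1
  brace : ∀ {n} {G : Graph n} → MatchingCovered G → Bipartite G →
          NoNontrivialTightCut G → BrickCount G 0
  split : ∀ {n m₁ m₂ k₁ k₂} {G : Graph n} {G₁ : Graph m₁} {G₂ : Graph m₂}
          (X : Fin n → Bool) → MatchingCovered G → Nontrivial X → Tight G X →
          Shrink G X G₁ → Shrink G (not ∘ X) G₂ →
          BrickCount G₁ k₁ → BrickCount G₂ k₂ → BrickCount G (k₁ + k₂)

Removable : ∀ {n} → Graph n → Fin n → Fin n → Set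
Removable G u v = MatchingCovered (G ─ (u , v))

-- b(G - e) = b(G); b is well defined (independent of the decomposition),
-- so this says every decomposition of G and every one of G - e give the
-- same number of bricks.
BInvariant : ∀ {n} → Graph n → Fin n → Fin n → Set
BInvariant G u v =
  Removable G u v ×
  (∀ k k' → BrickCount G k → BrickCount (G ─ (u , v)) k' → k ≡ k')

Solitary : ∀ {n} → Graph n → Fin n → Fin n → Set
Solitary G u v =
  Σ (PerfectMatching G) (λ M → mate M u ≡ v ×
     (∀ (M' : PerfectMatching G) → mate M' u ≡ v → ∀ w → mate M' w ≡ mate M w))

_≅_ : ∀ {n m} → Graph n → Graph m → Set
_≅_ {n} {m} G H = Σ (Fin n ↔ Fin m) (λ φ →
  ∀ u v → G u v ≡ H (Inverse.to φ u) (Inverse.to φ v))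

-- prism: a₁ a₂ a₃ b₁ b₂ b₃ = 0 1 2 3 4 5; plus a₁b₂
C6bar⁺ : Graph 6
C6bar⁺ = fromEdges
  ( (# 0 , # 1) ∷ (# 1 , # 2) ∷ (# 0 , # 2) ∷ (# 3 , # 4) ∷ (# 4 , # 5) ∷ (# 3 , # 5)
  ∷ (# 0 , # 3) ∷ (# 1 , # 4) ∷ (# 2 , # 5) ∷ (# 0 , # 4) ∷ [])

-- wheel: y₀ … y₅ = 0 … 5, hub y₀
W6edges : List (Fin 6 × Fin 6)
W6edges = (# 0 , # 1) ∷ (# 0 , # 2) ∷ (# 0 , # 3) ∷ (# 0 , # 4) ∷ (# 0 , # 5)
        ∷ (# 1 , # 2) ∷ (# 2 , # 3) ∷ (# 3 , # 4) ∷ (# 4 , # 5) ∷ (# 5 , # 1) ∷ []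

W6 : Graph 6
W6 = fromEdges W6edges

W6⁺ : Graph 6
W6⁺ = fromEdges ((# 1 , # 4) ∷ W6edges)

W6⁺⁺ : Graph 6
W6⁺⁺ = fromEdges ((# 1 , # 3) ∷ (# 1 , # 4) ∷ W6edges)

{-# OPTIONS --safe #-}
-- All four graphs have six vertices, so every edge e can be examined by listing the perfect
-- matchings of G and of G - e.  Each edge turns out to be solitary, or else G - e has an edge
-- that lies in no perfect matching, so e is not even removable.  The one exception is y₃y₄ in
-- W6⁺⁺: the cut ∂{y₀, y₂, y₃} of W6⁺⁺ - y₃y₄ is tight and both of its contractions are K₄,
-- so b(W6⁺⁺ - y₃y₄) = 2, while W6⁺⁺ itself is a brick.  All notions involved are invariant
-- under isomorphism, which carries the result over to every G isomorphic to one of the four.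
module Submission where

open import Defs
open import Data.Bool using (Bool; true; false; T; not; _∧_; _∨_; if_then_else_)
open import Data.Unit using (tt)
import Data.Bool.Properties as Bool
open import Data.Bool.Properties using (T-≡; T-∧; T-∨; T-not-≡; ¬-not; not-involutive; ∨-comm)
open import Data.Bool.ListAction using (all; any)
open import Data.Empty using (⊥-elim)
open import Data.Fin using (Fin; zero; suc; _≟_)
open import Data.Fin.Patterns using (0F; 1F; 2F; 3F; 4F; 5F)
open import Data.List using (List; []; _∷_; allFin; filterᵇ; cartesianProductWith; length)
open import Data.List.Membership.Propositional using (_∈_; find; lose)
import Data.List.Membership.DecPropositional as DecMembership
open import Data.List.Membership.Propositional.Properties
  using (∈-allFin; ∈-filter⁺; ∈-filter⁻; ∈-cartesianProductWith⁺; ∈-cartesianProductWith⁻)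
import Data.List.Relation.Unary.All as All
open import Data.List.Relation.Unary.All.Properties using (all⁺; all⁻; tabulate⁺)
open import Data.List.Relation.Unary.Any using (here; there; satisfied)
open import Data.List.Relation.Unary.Any.Properties using (any⁺; any⁻)
open import Data.Nat using (ℕ; _+_; _≤_; _≡ᵇ_; _<ᵇ_; s≤s; z≤n)
open import Data.Nat.Properties using (+-0-commutativeMonoid; ≡ᵇ⇒≡; ≡⇒≡ᵇ; <⇒<ᵇ)
open import Algebra.Properties.CommutativeMonoid.Sum +-0-commutativeMonoid using (sum; sum-permute)
open import Data.Product using (Σ; ∃; ∃-syntax; ∃₂; _×_; _,_; proj₁; proj₂)
open import Data.Product.Properties using (≡-dec)
open import Data.Sum using (_⊎_; inj₁; inj₂)
import Data.Vec.Functional as Vector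
open import Function using (_∘_; _⇔_; Equivalence; mk⇔; case_of_)
open import Function.Bundles using (Inverse; mk↔ₛ′)
open import Relation.Nullary using (¬_)
open import Relation.Nullary.Decidable using (⌊_⌋; yes; no; T?; toWitness; fromWitness; toWitnessFalse; fromWitnessFalse)
open import Relation.Binary.PropositionalEquality
  using (_≡_; _≢_; _≗_; refl; sym; trans; cong; cong₂; subst; subst₂; module ≡-Reasoning)

private
  variable
    n m k : ℕ

count-cong : {p q : Fin n → Bool} → p ≗ q → count p ≡ count q
count-cong {ℕ.zero}  p≗q = refl
count-cong {ℕ.suc n} p≗q = cong₂ (λ b c → (if b then 1 else 0) + c) (p≗q zero) (count-cong (p≗q ∘ suc))

cutSize : (Fin n → Fin n) → (Fin n → Bool) → ℕ
cutSize μ X = count (λ v → X v ∧ not (X (μ v)))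

cutSize-cong : ∀ {μ μ′ : Fin n → Fin n} {X Y} → μ ≗ μ′ → X ≗ Y → cutSize μ X ≡ cutSize μ′ Y
cutSize-cong {μ = μ} {μ′} {X} {Y} μ≗μ′ X≗Y =
  count-cong λ v → cong₂ (λ a b → a ∧ not b) (X≗Y v) (trans (cong X (μ≗μ′ v)) (X≗Y (μ′ v)))

-- Isomorphism invariance

record Iso (G : Graph n) (H : Graph m) : Set where
  field
    to      : Fin n → Fin m
    from    : Fin m → Fin n
    from∘to : ∀ x → from (to x) ≡ x
    to∘from : ∀ y → to (from y) ≡ y
    adj     : ∀ u v → G u v ≡ H (to u) (to v)

  adj⁻ : ∀ a b → H a b ≡ G (from a) (from b)
  adj⁻ a b = trans (cong₂ H (sym (to∘from a)) (sym (to∘from b))) (sym (adj (from a) (from b)))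

  edge : ∀ {u v} → G u v ≡ true → H (to u) (to v) ≡ true
  edge {u} {v} = trans (sym (adj u v))

  edge⁻ : ∀ {a b} → H a b ≡ true → G (from a) (from b) ≡ true
  edge⁻ {a} {b} = trans (sym (adj⁻ a b))

  to-injective : ∀ {x y} → to x ≡ to y → x ≡ y
  to-injective {x} {y} eq = trans (sym (from∘to x)) (trans (cong from eq) (from∘to y))

≅⇒Iso : {G : Graph n} {H : Graph m} → G ≅ H → Iso G H
≅⇒Iso (φ , adj) = record
  { to = Inverse.to φ ; from = Inverse.from φ
  ; from∘to = Inverse.strictlyInverseʳ φ ; to∘from = Inverse.strictlyInverseˡ φ ; adj = adj }

Iso-sym : {G : Graph n} {H : Graph m} → Iso G H → Iso H G
Iso-sym I = record { to = from ; from = to ; from∘to = to∘from ; to∘from = from∘to ; adj = adj⁻ }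
  where open Iso I

≗⇒Iso : {G H : Graph n} → (∀ u v → G u v ≡ H u v) → Iso G H
≗⇒Iso G≗H = record { to = λ x → x ; from = λ x → x ; from∘to = λ _ → refl ; to∘from = λ _ → refl ; adj = G≗H }

module _ {G : Graph n} {H : Graph m} (I : Iso G H) where
  open Iso I

  PerfectMatching-transport : PerfectMatching G → PerfectMatching H
  PerfectMatching-transport M = record
    { mate    = to ∘ mate M ∘ from
    ; isEdge  = λ w → subst (λ z → H z (to (mate M (from w))) ≡ true) (to∘from w) (edge (isEdge M (from w)))
    ; involut = λ w → trans (cong (to ∘ mate M) (from∘to _)) (trans (cong to (involut M (from w))) (to∘from w)) }

  Reach-transport : ∀ {u v} → Reach G u v → Reach H (to u) (to v)
  Reach-transport here       = here
  Reach-transport (step e r) = step (edge e) (Reach-transport r)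

  MatchingCovered-transport : MatchingCovered G → MatchingCovered H
  MatchingCovered-transport (connected , (u , v , e) , matchable) =
    (λ a b → subst₂ (Reach H) (to∘from a) (to∘from b) (Reach-transport (connected (from a) (from b))))
    , (to u , to v , edge e)
    , λ a b e → let M , Mab = matchable (from a) (from b) (edge⁻ e)
                in PerfectMatching-transport M , trans (cong to Mab) (to∘from b)

  Bipartite-transport : Bipartite G → Bipartite H
  Bipartite-transport (colour , proper) = colour ∘ from , λ a b e → proper (from a) (from b) (edge⁻ e)

  count-transport : (p : Fin m → Bool) → count (p ∘ to) ≡ count p
  count-transport p = begin
    count (p ∘ to)                          ≡⟨ count-sum (p ∘ to) ⟩
    sum (λ x → if p (to x) then 1 else 0)   ≡⟨ sum-permute (λ y → if p y then 1 else 0) (mk↔ₛ′ to from to∘from from∘to) ⟨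
    sum (λ y → if p y then 1 else 0)        ≡⟨ count-sum p ⟨
    count p                                 ∎
    where
    open ≡-Reasoning
    count-sum : ∀ {k} (q : Fin k → Bool) → count q ≡ sum (λ i → if q i then 1 else 0)
    count-sum {ℕ.zero}  q = refl
    count-sum {ℕ.suc k} q = cong ((if q zero then 1 else 0) +_) (count-sum (q ∘ suc))

  Shrink-transport : ∀ {X} {G₁ : Graph k} → Shrink G X G₁ → Shrink H (X ∘ from) G₁
  Shrink-transport S = record
    { f        = S.f ∘ from
    ; surj     = λ w → let v , fv≡w = S.surj w in to v , trans (cong S.f (from∘to v)) fv≡w
    ; collapse = λ a b → S.collapse (from a) (from b)
    ; inj      = λ a b Xa fa≡fb → trans (sym (to∘from a)) (trans (cong to (S.inj (from a) (from b) Xa fa≡fb)) (to∘from b))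
    ; adj→     = λ a b e → let u , v , fu , fv , Guv , a≢b = S.adj→ a b e in
                 to u , to v , trans (cong S.f (from∘to u)) fu , trans (cong S.f (from∘to v)) fv , edge Guv , a≢b
    ; adj←     = λ { a b (u , v , fu , fv , Huv , a≢b) → S.adj← a b (from u , from v , fu , fv , edge⁻ Huv , a≢b) } }
    where module S = Shrink S

  ≟-transport : ∀ x y → ⌊ x ≟ y ⌋ ≡ ⌊ to x ≟ to y ⌋
  ≟-transport x y with x ≟ y | to x ≟ to y
  ... | yes _    | yes _     = refl
  ... | no _     | no _      = refl
  ... | yes refl | no tx≢tx  = ⊥-elim (tx≢tx refl)
  ... | no x≢y   | yes tx≡ty = ⊥-elim (x≢y (to-injective tx≡ty))

  ─-transport : ∀ u v → Iso (G ─ (u , v)) (H ─ (to u , to v))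
  ─-transport u v = record
    { to = to ; from = from ; from∘to = from∘to ; to∘from = to∘from
    ; adj = λ x y → cong₂ (λ g d → g ∧ not d) (adj x y)
              (cong₂ _∨_ (cong₂ _∧_ (≟-transport x u) (≟-transport y v))
                         (cong₂ _∧_ (≟-transport x v) (≟-transport y u))) }

module _ {G : Graph n} {H : Graph m} (I : Iso G H) where
  open Iso I

  Tight-transport : ∀ {X} → Tight G X → Tight H (X ∘ from)
  Tight-transport {X} tight M = begin
    cutCount M (X ∘ from)                                  ≡⟨ count-transport I _ ⟨
    count (λ v → X (from (to v)) ∧ not (X (from (mate M (to v)))))
                                    ≡⟨ count-cong (λ v → cong (λ x → X x ∧ not (X (from (mate M (to v))))) (from∘to v)) ⟩
    cutCount (PerfectMatching-transport (Iso-sym I) M) X   ≡⟨ tight (PerfectMatching-transport (Iso-sym I) M) ⟩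
    1                                                      ∎
    where open ≡-Reasoning

  Solitary-transport : ∀ {u v} → Solitary G u v → Solitary H (to u) (to v)
  Solitary-transport {u} {v} (M , Muv , unique) =
    PerfectMatching-transport I M , trans (cong (to ∘ mate M) (from∘to u)) (cong to Muv) ,
    λ M′ M′uv w → trans (sym (to∘from (mate M′ w)))
       (cong to (trans (cong (from ∘ mate M′) (sym (to∘from w)))
                       (unique (PerfectMatching-transport (Iso-sym I) M′) (trans (cong from M′uv) (from∘to v)) (from w))))

  Nontrivial-transport : ∀ {X} → Nontrivial X → Nontrivial (X ∘ from)
  Nontrivial-transport {X} (inX , outX) =
    subst (2 ≤_) (sym (count-transport (Iso-sym I) X)) inX ,
    subst (2 ≤_) (sym (count-transport (Iso-sym I) (not ∘ X))) outX

module _ {G : Graph n} {H : Graph m} (I : Iso G H) where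
  open Iso I

  NoNontrivialTightCut-transport : NoNontrivialTightCut G → NoNontrivialTightCut H
  NoNontrivialTightCut-transport noCut X nontrivial tight =
    noCut (X ∘ to) (Nontrivial-transport (Iso-sym I) {X} nontrivial) (Tight-transport (Iso-sym I) {X} tight)

  BrickCount-transport : BrickCount G k → BrickCount H k
  BrickCount-transport (brick mc ¬bip noCut) =
    brick (MatchingCovered-transport I mc) (¬bip ∘ Bipartite-transport (Iso-sym I)) (NoNontrivialTightCut-transport noCut)
  BrickCount-transport (brace mc bip noCut) =
    brace (MatchingCovered-transport I mc) (Bipartite-transport I bip) (NoNontrivialTightCut-transport noCut)
  BrickCount-transport (split X mc nontrivial tight S₁ S₂ b₁ b₂) =
    split (X ∘ from) (MatchingCovered-transport I mc) (Nontrivial-transport I {X} nontrivial) (Tight-transport I {X} tight)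
          (Shrink-transport I S₁) (Shrink-transport I S₂) b₁ b₂

BInvariant-transport : {G : Graph n} {H : Graph m} (I : Iso G H) →
  ∀ {u v} → BInvariant G u v → BInvariant H (Iso.to I u) (Iso.to I v)
BInvariant-transport I {u} {v} (removable , invariant) =
  MatchingCovered-transport (─-transport I u v) removable ,
  λ k k′ b b′ → invariant k k′ (BrickCount-transport (Iso-sym I) b) (BrickCount-transport (Iso-sym (─-transport I u v)) b′)

BInvariantEdgesSolitary : Graph n → Set
BInvariantEdgesSolitary G = ∀ u v → G u v ≡ true → BInvariant G u v → Solitary G u v

BInvariantEdgesSolitary-transport : {G : Graph n} {H : Graph m} → Iso G H →
  BInvariantEdgesSolitary H → BInvariantEdgesSolitary G
BInvariantEdgesSolitary-transport {G = G} I solitaryH u v e bi =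
  subst₂ (Solitary G) (from∘to u) (from∘to v)
    (Solitary-transport (Iso-sym I) (solitaryH (to u) (to v) (edge e) (BInvariant-transport I bi)))
  where open Iso I

-- Deciding matching properties by enumeration

open Equivalence using (to; from)

infixr 4 _⇒ᵇ_
_⇒ᵇ_ : Bool → Bool → Bool
a ⇒ᵇ b = not a ∨ b

T-⇒ᵇ : ∀ {a b} → T (a ⇒ᵇ b) ⇔ (T a → T b)
T-⇒ᵇ {true}  = mk⇔ (λ h _ → h) (λ h → h _)
T-⇒ᵇ {false} = mk⇔ (λ _ ()) (λ _ → _)

T-not-¬ : ∀ {a} → T (not a) → ¬ T a
T-not-¬ {false} _ ()

T-all-allFin : {p : Fin n → Bool} → T (all p (allFin n)) ⇔ (∀ i → T (p i))
T-all-allFin {p = p} = mk⇔ (λ h i → All.lookup (all⁺ p _ h) (∈-allFin i)) (λ h → all⁻ p (tabulate⁺ h))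

T-any-allFin : {p : Fin n → Bool} → T (any p (allFin n)) ⇔ ∃ (T ∘ p)
T-any-allFin {p = p} = mk⇔ (satisfied ∘ any⁻ p (allFin _)) (λ (i , pᵢ) → any⁺ p (lose (∈-allFin i) pᵢ))

allPairs : (Fin n → Fin n → Bool) → Bool
allPairs p = all (λ u → all (p u) (allFin _)) (allFin _)

T-allPairs : {p : Fin n → Fin n → Bool} → T (allPairs p) ⇔ (∀ u v → T (p u v))
T-allPairs = mk⇔ (λ h u → to T-all-allFin (to T-all-allFin h u)) (λ h → from T-all-allFin (λ u → from T-all-allFin (h u)))

anyPairs : (Fin n → Fin m → Bool) → Bool
anyPairs p = any (λ u → any (p u) (allFin _)) (allFin _)

T-anyPairs : {p : Fin n → Fin m → Bool} → T (anyPairs p) ⇔ ∃₂ λ u v → T (p u v)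
T-anyPairs = mk⇔ (λ h → let u , h′ = to T-any-allFin h ; v , puv = to T-any-allFin h′ in u , v , puv)
                 (λ (u , v , puv) → from T-any-allFin (u , from T-any-allFin (v , puv)))

choices : {A : Set} → (Fin n → List A) → List (Fin n → A)
choices {ℕ.zero}  cs = (λ ()) ∷ []
choices {ℕ.suc n} cs = cartesianProductWith Vector._∷_ (cs zero) (choices (cs ∘ suc))

choices-sound : {A : Set} (cs : Fin n → List A) {f : Fin n → A} → f ∈ choices cs → ∀ i → f i ∈ cs i
choices-sound {ℕ.suc n} cs f∈ i with ∈-cartesianProductWith⁻ Vector._∷_ (cs zero) (choices (cs ∘ suc)) f∈
choices-sound {ℕ.suc n} cs f∈ zero    | x , g , x∈ , g∈ , refl = x∈
choices-sound {ℕ.suc n} cs f∈ (suc i) | x , g , x∈ , g∈ , refl = choices-sound (cs ∘ suc) g∈ i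

choices-complete : {A : Set} (cs : Fin n → List A) (f : Fin n → A) → (∀ i → f i ∈ cs i) →
  ∃[ g ] g ∈ choices cs × g ≗ f
choices-complete {ℕ.zero}  cs f _  = (λ ()) , here refl , λ ()
choices-complete {ℕ.suc n} cs f f∈ =
  let g , g∈ , g≗ = choices-complete (cs ∘ suc) (f ∘ suc) (f∈ ∘ suc)
  in f zero Vector.∷ g , ∈-cartesianProductWith⁺ Vector._∷_ (f∈ zero) g∈ , λ { zero → refl ; (suc i) → g≗ i }

neighbours : Graph n → Fin n → List (Fin n)
neighbours G v = filterᵇ (G v) (allFin _)

isInvolution : (Fin n → Fin n) → Bool
isInvolution μ = all (λ v → ⌊ μ (μ v) ≟ v ⌋) (allFin _)

perfectMatchings : Graph n → List (Fin n → Fin n)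
perfectMatchings G = filterᵇ isInvolution (choices (neighbours G))

toPerfectMatching : {G : Graph n} {μ : Fin n → Fin n} → μ ∈ perfectMatchings G → PerfectMatching G
toPerfectMatching {G = G} {μ} μ∈ =
  let μ∈choices , involution = ∈-filter⁻ (T? ∘ isInvolution) μ∈ in record
  { mate    = μ
  ; isEdge  = λ v → to T-≡ (proj₂ (∈-filter⁻ (T? ∘ G v) {xs = allFin _} (choices-sound (neighbours G) μ∈choices v)))
  ; involut = λ v → toWitness (to T-all-allFin involution v) }

perfectMatchings-complete : {G : Graph n} (M : PerfectMatching G) → ∃[ μ ] μ ∈ perfectMatchings G × μ ≗ mate M
perfectMatchings-complete {G = G} M =
  let μ , μ∈ , μ≗M = choices-complete (neighbours G) (mate M)
                       (λ v → ∈-filter⁺ (T? ∘ G v) (∈-allFin (mate M v)) (from T-≡ (isEdge M v)))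
      involution = λ v → trans (μ≗M (μ v)) (trans (cong (mate M) (μ≗M v)) (involut M v))
  in μ , ∈-filter⁺ (T? ∘ isInvolution) μ∈ (from T-all-allFin (fromWitness ∘ involution)) , μ≗M

EdgesMatchable : Graph n → Set
EdgesMatchable G = ∀ u v → G u v ≡ true → Σ (PerfectMatching G) (λ M → mate M u ≡ v)

edgesMatchable? : Graph n → Bool
edgesMatchable? G = allPairs λ u v → G u v ⇒ᵇ any (λ μ → ⌊ μ u ≟ v ⌋) (perfectMatchings G)

T-edgesMatchable? : {G : Graph n} → T (edgesMatchable? G) ⇔ EdgesMatchable G
T-edgesMatchable? {G = G} = mk⇔ sound complete
  where
  sound : T (edgesMatchable? G) → EdgesMatchable G
  sound h u v e =
    let μ , μ∈ , μuv = find (any⁻ _ _ (to T-⇒ᵇ (to T-allPairs h u v) (from T-≡ e)))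
    in toPerfectMatching μ∈ , toWitness μuv
  complete : EdgesMatchable G → T (edgesMatchable? G)
  complete matchable = from T-allPairs λ u v → from T-⇒ᵇ λ e →
    let M , Muv = matchable u v (to T-≡ e) ; μ , μ∈ , μ≗M = perfectMatchings-complete M
    in any⁺ _ (lose μ∈ (fromWitness (trans (μ≗M u) Muv)))

matchingsThrough : Graph n → Fin n → Fin n → List (Fin n → Fin n)
matchingsThrough G a b = filterᵇ (λ μ → ⌊ μ a ≟ b ⌋) (perfectMatchings G)

solitary? : Graph n → Fin n → Fin n → Bool
solitary? G a b = length (matchingsThrough G a b) ≡ᵇ 1

length≡1⇒singleton : {A : Set} (xs : List A) → length xs ≡ 1 → ∃[ x ] xs ≡ x ∷ []
length≡1⇒singleton (x ∷ []) _ = x , refl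

solitary?-sound : {G : Graph n} {a b : Fin n} → T (solitary? G a b) → Solitary G a b
solitary?-sound {G = G} {a} {b} h = solitary (length≡1⇒singleton _ (≡ᵇ⇒≡ _ 1 h))
  where
  through? = T? ∘ λ (μ : Fin _ → Fin _) → ⌊ μ a ≟ b ⌋
  solitary : ∃[ μ ] matchingsThrough G a b ≡ μ ∷ [] → Solitary G a b
  solitary (μ , only-μ) =
    let μ∈ , μab = ∈-filter⁻ through? (subst (μ ∈_) (sym only-μ) (here refl))
    in toPerfectMatching μ∈ , toWitness μab , λ M′ M′ab w →
      let μ′ , μ′∈ , μ′≗M′ = perfectMatchings-complete M′
          μ′∈through = ∈-filter⁺ through? μ′∈ (fromWitness (trans (μ′≗M′ a) M′ab))
      in case subst (μ′ ∈_) only-μ μ′∈through of λ { (here refl) → sym (μ′≗M′ w) }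

nontrivial? : (Fin n → Bool) → Bool
nontrivial? X = (1 <ᵇ count X) ∧ (1 <ᵇ count (not ∘ X))

tight? : Graph n → (Fin n → Bool) → Bool
tight? G X = all (λ μ → cutSize μ X ≡ᵇ 1) (perfectMatchings G)

tight?-sound : {G : Graph n} {X : Fin n → Bool} → T (tight? G X) → Tight G X
tight?-sound {X = X} h M =
  let μ , μ∈ , μ≗M = perfectMatchings-complete M
  in trans (cutSize-cong {X = X} (sym ∘ μ≗M) (λ _ → refl)) (≡ᵇ⇒≡ _ 1 (All.lookup (all⁺ _ _ h) μ∈))

subsets : List (Fin n → Bool)
subsets = choices (λ _ → true ∷ false ∷ [])

bool∈ : ∀ b → b ∈ true ∷ false ∷ []
bool∈ true  = here refl
bool∈ false = there (here refl)

noNontrivialTightCut? : Graph n → Bool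
noNontrivialTightCut? G =
  all (λ X → nontrivial? X ⇒ᵇ any (λ μ → not (cutSize μ X ≡ᵇ 1)) (perfectMatchings G)) subsets

noNontrivialTightCut?-sound : {G : Graph n} → T (noNontrivialTightCut? G) → NoNontrivialTightCut G
noNontrivialTightCut?-sound h X (inX , outX) tight =
  let Y , Y∈ , Y≗X = choices-complete _ X (bool∈ ∘ X)
      nontrivialY = from T-∧ ( <⇒<ᵇ (subst (2 ≤_) (count-cong (sym ∘ Y≗X)) inX)
                             , <⇒<ᵇ (subst (2 ≤_) (count-cong (cong not ∘ sym ∘ Y≗X)) outX))
      μ , μ∈ , notTight = find (any⁻ _ _ (to T-⇒ᵇ (All.lookup (all⁺ _ _ h) Y∈) nontrivialY))
  in T-not-¬ notTight (≡⇒≡ᵇ _ 1 (trans (cutSize-cong (λ _ → refl) Y≗X) (tight (toPerfectMatching μ∈))))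

universal? : Graph n → Fin n → Bool
universal? G h = all (λ v → ⌊ v ≟ h ⌋ ∨ (G h v ∧ G v h)) (allFin _)

Reach-trans : {G : Graph n} {u v w : Fin n} → Reach G u v → Reach G v w → Reach G u w
Reach-trans here       r = r
Reach-trans (step e r) r′ = step e (Reach-trans r r′)

universal?-connected : {G : Graph n} {h : Fin n} → T (universal? G h) → Connected G
universal?-connected {G = G} {h} universal u v = Reach-trans (proj₁ (via-h u)) (proj₂ (via-h v))
  where
  via-h : ∀ v → Reach G v h × Reach G h v
  via-h v with to T-∨ (to T-all-allFin universal v)
  ... | inj₁ v≡h = subst (λ w → Reach G w h × Reach G h w) (sym (toWitness v≡h)) (here , here)
  ... | inj₂ hv∧vh = let hv , vh = to T-∧ hv∧vh in step (to T-≡ vh) here , step (to T-≡ hv) here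

matchingCovered-by : (G : Graph n) (h u v : Fin n) →
  T (universal? G h) → G u v ≡ true → T (edgesMatchable? G) → MatchingCovered G
matchingCovered-by G h u v universal e matchable =
  universal?-connected universal , (u , v , e) , to T-edgesMatchable? matchable

triangle⇒¬Bipartite : {G : Graph n} {x y z : Fin n} →
  G x y ≡ true → G y z ≡ true → G x z ≡ true → ¬ Bipartite G
triangle⇒¬Bipartite xy yz xz (colour , proper) =
  proper _ _ xz (trans (¬-not (proper _ _ xy)) (trans (cong not (¬-not (proper _ _ yz))) (not-involutive _)))

brick-by : (G : Graph n) (h x y z : Fin n) → T (universal? G h) →
  G x y ≡ true → G y z ≡ true → G x z ≡ true →
  T (edgesMatchable? G) → T (noNontrivialTightCut? G) → BrickCount G 1
brick-by G h x y z universal xy yz xz matchable noCut =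
  brick (matchingCovered-by G h x y universal xy matchable) (triangle⇒¬Bipartite xy yz xz)
        (noNontrivialTightCut?-sound noCut)

imageAdjacent : Graph n → (Fin n → Fin m) → Fin m → Fin m → Bool
imageAdjacent G f a b = not ⌊ a ≟ b ⌋ ∧ anyPairs λ u v → ⌊ f u ≟ a ⌋ ∧ ⌊ f v ≟ b ⌋ ∧ G u v

T-imageAdjacent : {G : Graph n} {f : Fin n → Fin m} {a b : Fin m} →
  T (imageAdjacent G f a b) ⇔ (a ≢ b × ∃₂ λ u v → f u ≡ a × f v ≡ b × G u v ≡ true)
T-imageAdjacent {G = G} {f} {a} {b} = mk⇔
  (λ h → let a≢b , ∃uv = to (T-∧ {not ⌊ a ≟ b ⌋}) h
             u , v , fu∧fv∧Guv = to T-anyPairs ∃uv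
             fu , fv∧Guv = to (T-∧ {⌊ f u ≟ a ⌋}) fu∧fv∧Guv
             fv , Guv = to (T-∧ {⌊ f v ≟ b ⌋}) fv∧Guv
         in toWitnessFalse a≢b , u , v , toWitness fu , toWitness fv , to T-≡ Guv)
  (λ (a≢b , u , v , fu , fv , Guv) → from (T-∧ {not ⌊ a ≟ b ⌋}) (fromWitnessFalse a≢b , from T-anyPairs
     (u , v , from (T-∧ {⌊ f u ≟ a ⌋}) (fromWitness fu , from (T-∧ {⌊ f v ≟ b ⌋}) (fromWitness fv , from T-≡ Guv)))))

shrink-by : (G : Graph n) (X : Fin n → Bool) (H : Graph m) (f : Fin n → Fin m) (g : Fin m → Fin n) →
  T (all (λ w → ⌊ f (g w) ≟ w ⌋) (allFin m)) →
  T (allPairs λ u v → X u ∧ X v ⇒ᵇ ⌊ f u ≟ f v ⌋) →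
  T (allPairs λ u v → not (X u) ∧ ⌊ f u ≟ f v ⌋ ⇒ᵇ ⌊ u ≟ v ⌋) →
  T (allPairs λ a b → ⌊ H a b Bool.≟ imageAdjacent G f a b ⌋) →
  Shrink G X H
shrink-by G X H f g section collapse inj image = record
  { f        = f
  ; surj     = λ w → g w , toWitness (to T-all-allFin section w)
  ; collapse = λ u v Xu Xv → toWitness (to T-⇒ᵇ (to T-allPairs collapse u v) (from T-∧ (from T-≡ Xu , from T-≡ Xv)))
  ; inj      = λ u v ¬Xu fu≡fv →
                 toWitness (to T-⇒ᵇ (to T-allPairs inj u v) (from T-∧ (from T-not-≡ ¬Xu , fromWitness fu≡fv)))
  ; adj→     = λ a b Hab →
                 let a≢b , u , v , fu , fv , Guv =
                       to (T-imageAdjacent {G = G} {f}) (subst T (toWitness (to T-allPairs image a b)) (from T-≡ Hab))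
                 in u , v , fu , fv , Guv , a≢b
  ; adj←     = λ { a b (u , v , fu , fv , Guv , a≢b) →
                 trans (toWitness (to T-allPairs image a b))
                       (to T-≡ (from (T-imageAdjacent {G = G} {f}) (a≢b , u , v , fu , fv , Guv))) } }

b-variant-if-brickCount-changes : {G : Graph n} {u v : Fin n} {k k′ : ℕ} →
  BrickCount G k → BrickCount (G ─ (u , v)) k′ → k ≢ k′ → ¬ BInvariant G u v
b-variant-if-brickCount-changes b b′ k≢k′ (_ , invariant) = k≢k′ (invariant _ _ b b′)

─-comm : (G : Graph n) (u v : Fin n) → ∀ a b → (G ─ (u , v)) a b ≡ (G ─ (v , u)) a b
─-comm G u v a b = cong (λ d → G a b ∧ not d) (∨-comm (⌊ a ≟ u ⌋ ∧ ⌊ b ≟ v ⌋) (⌊ a ≟ v ⌋ ∧ ⌊ b ≟ u ⌋))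

solitaryOrNonRemovable? : Graph n → Fin n → Fin n → Bool
solitaryOrNonRemovable? G u v = solitary? G u v ∨ not (edgesMatchable? (G ─ (u , v)))

module _ {n : ℕ} where
  open DecMembership (≡-dec (_≟_ {n}) (_≟_ {n})) using (_∈?_)

  BInvariantEdgesSolitary-by : (G : Graph n) (exempt : List (Fin n × Fin n)) →
    (∀ {u v} → (u , v) ∈ exempt → ¬ BInvariant G u v) →
    T (allPairs λ u v → G u v ⇒ᵇ ⌊ (u , v) ∈? exempt ⌋ ∨ solitaryOrNonRemovable? G u v) →
    BInvariantEdgesSolitary G
  BInvariantEdgesSolitary-by G exempt b-variant check u v e bi
    with to (T-∨ {⌊ (u , v) ∈? exempt ⌋}) (to (T-⇒ᵇ {G u v}) (to T-allPairs check u v) (from T-≡ e))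
  ... | inj₁ exempted = ⊥-elim (b-variant (toWitness exempted) bi)
  ... | inj₂ verdict with to (T-∨ {solitary? G u v}) verdict
  ...   | inj₁ solitary  = solitary?-sound solitary
  ...   | inj₂ unmatched = ⊥-elim (T-not-¬ unmatched (from T-edgesMatchable? (proj₂ (proj₂ (proj₁ bi)))))

-- The four graphs

K4 : Graph 4
K4 = fromEdges ((0F , 1F) ∷ (0F , 2F) ∷ (0F , 3F) ∷ (1F , 2F) ∷ (1F , 3F) ∷ (2F , 3F) ∷ [])

K4-brick : BrickCount K4 1
K4-brick = brick-by K4 0F 0F 1F 2F tt refl refl refl tt tt

W6⁺⁺-brick : BrickCount W6⁺⁺ 1
W6⁺⁺-brick = brick-by W6⁺⁺ 0F 0F 1F 2F tt refl refl refl tt tt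

W6⁺⁺-y₃y₄-brickCount : BrickCount (W6⁺⁺ ─ (3F , 4F)) 2
W6⁺⁺-y₃y₄-brickCount =
  split X (matchingCovered-by G 0F 0F 1F tt refl tt) (s≤s (s≤s z≤n) , s≤s (s≤s z≤n)) (tight?-sound {X = X} tt)
    (shrink-by G X K4 (Vector.fromList (0F ∷ 1F ∷ 0F ∷ 0F ∷ 2F ∷ 3F ∷ []))
                      (Vector.fromList (0F ∷ 1F ∷ 4F ∷ 5F ∷ [])) tt tt tt tt)
    (shrink-by G (not ∘ X) K4 (Vector.fromList (1F ∷ 0F ∷ 2F ∷ 3F ∷ 0F ∷ 0F ∷ []))
                              (Vector.fromList (1F ∷ 0F ∷ 2F ∷ 3F ∷ [])) tt tt tt tt)
    K4-brick K4-brick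
  where
  G = W6⁺⁺ ─ (3F , 4F)
  X = Vector.fromList (true ∷ false ∷ true ∷ true ∷ false ∷ false ∷ [])

W6⁺⁺-y₃y₄-b-variant : ∀ {u v} → (u , v) ∈ (3F , 4F) ∷ (4F , 3F) ∷ [] → ¬ BInvariant W6⁺⁺ u v
W6⁺⁺-y₃y₄-b-variant (here refl) =
  b-variant-if-brickCount-changes W6⁺⁺-brick W6⁺⁺-y₃y₄-brickCount (λ ())
W6⁺⁺-y₃y₄-b-variant (there (here refl)) =
  b-variant-if-brickCount-changes W6⁺⁺-brick
    (BrickCount-transport (≗⇒Iso (─-comm W6⁺⁺ 3F 4F)) W6⁺⁺-y₃y₄-brickCount) (λ ())

C6bar⁺-BInvariantEdgesSolitary : BInvariantEdgesSolitary C6bar⁺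
C6bar⁺-BInvariantEdgesSolitary = BInvariantEdgesSolitary-by C6bar⁺ [] (λ ()) tt

W6-BInvariantEdgesSolitary : BInvariantEdgesSolitary W6
W6-BInvariantEdgesSolitary = BInvariantEdgesSolitary-by W6 [] (λ ()) tt

W6⁺-BInvariantEdgesSolitary : BInvariantEdgesSolitary W6⁺
W6⁺-BInvariantEdgesSolitary = BInvariantEdgesSolitary-by W6⁺ [] (λ ()) tt

W6⁺⁺-BInvariantEdgesSolitary : BInvariantEdgesSolitary W6⁺⁺
W6⁺⁺-BInvariantEdgesSolitary =
  BInvariantEdgesSolitary-by W6⁺⁺ ((3F , 4F) ∷ (4F , 3F) ∷ []) W6⁺⁺-y₃y₄-b-variant tt

lemma2p3 : ∀ {n} (G : Graph n) →
    (G ≅ C6bar⁺ ⊎ G ≅ W6 ⊎ G ≅ W6⁺ ⊎ G ≅ W6⁺⁺) →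
    ∀ (u v : Fin n) → G u v ≡ true → BInvariant G u v → Solitary G u v
lemma2p3 G (inj₁ G≅C6bar⁺) =
  BInvariantEdgesSolitary-transport (≅⇒Iso G≅C6bar⁺) C6bar⁺-BInvariantEdgesSolitary
lemma2p3 G (inj₂ (inj₁ G≅W6)) =
  BInvariantEdgesSolitary-transport (≅⇒Iso G≅W6) W6-BInvariantEdgesSolitary
lemma2p3 G (inj₂ (inj₂ (inj₁ G≅W6⁺))) =
  BInvariantEdgesSolitary-transport (≅⇒Iso G≅W6⁺) W6⁺-BInvariantEdgesSolitary
lemma2p3 G (inj₂ (inj₂ (inj₂ G≅W6⁺⁺))) =
  BInvariantEdgesSolitary-transport (≅⇒Iso G≅W6⁺⁺) W6⁺⁺-BInvariantEdgesSolitary
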